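{- (Soundness of QFUA and QBUA triples.) For all resource functions $P,Q$ and commands $C$: (i) if $\vdash_{\mathsf F}[P]\,C\,[Q]$ is derivable with the QFUA rules, then $\vDash_{\mathsf F}[P]\,C\,[Q]$ holds; (ii) if $\vdash_{\mathsf B}[P]\,C\,[Q]$ is derivable with the QBUA rules, then $\vDash_{\mathsf B}[P]\,C\,[Q]$ holds.
   Context: Commands over integer-valued program variables: $C ::= \mathsf{skip} \mid x:=e \mid \mathsf{assume}(B) \mid \mathsf{tick}(e) \mid C;C \mid C+C \mid C^\star \mid \mathsf{local}\ x\ \mathsf{in}\ C$, where $e$ is an arithmetic expression, $B$ a Boolean expression, $+$ nondeterministic choice, $C^\star$ nondeterministic iteration. States are $\sigma:\mathit{Var}\to\mathbb Z$; $[\![e]\!]_\sigma$ is evaluation. Big-step semantics $\langle C,\sigma,p\rangle\Downarrow_l\langle\tau,q\rangle$ (start in $\sigma$ with resource $p\in\mathbb Z$, end in $\tau$ with resource $q$, $l$ = minimal resource level seen): skip: $\langle\mathsf{skip},\sigma,p\rangle\Downarrow_p\langle\sigma,p\rangle$; assign: $\langle x:=e,\sigma,p\rangle\Downarrow_p\langle\sigma[x\mapsto[\![e]\!]_\sigma],p\rangle$; assume: if $[\![B]\!]_\sigma=\mathsf{true}$ then $\langle\mathsf{assume}(B),\sigma,p\rangle\Downarrow_p\langle\sigma,p\rangle$; tick: $\langle\mathsf{tick}(e),\sigma,p\rangle\Downarrow_{\min(p,p-[\![e]\!]_\sigma)}\langle\sigma,p-[\![e]\!]_\sigma\rangle$;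 seq: from $\langle C_1,\sigma,p\rangle\Downarrow_{l_1}\langle\rho,r\rangle$ and $\langle C_2,\rho,r\rangle\Downarrow_{l_2}\langle\tau,q\rangle$ infer $\langle C_1;C_2,\sigma,p\rangle\Downarrow_{\min(l_1,l_2)}\langle\tau,q\rangle$; choice: any run of $C_1$ or of $C_2$ is a run of $C_1+C_2$ with the same $l$; loop: $\langle C^\star,\sigma,p\rangle\Downarrow_p\langle\sigma,p\rangle$, and any run of $C;C^\star$ is a run of $C^\star$; local: from $\langle C,\sigma,p\rangle\Downarrow_l\langle\tau,q\rangle$ infer $\langle\mathsf{local}\ x\ \mathsf{in}\ C,\sigma[x\mapsto v],p\rangle\Downarrow_l\langle\tau[x\mapsto v],q\rangle$. Write $\langle C,\sigma,p\rangle\Downarrow\langle\tau,q\rangle$ for $\exists l$. Resource functions are $P:\mathit{State}\to\mathbb Z\cup\{\pm\infty\}$. Pointwise $\max(P,Q)$, $\min(P,Q)$, $P+F$, $P-e$; $\mathsf{Sup}\,x.P:=\lambda\sigma.\sup_v P(\sigma[x\mapsto v])$, $\mathsf{Inf}\,x.P:=\lambda\sigma.\inf_v P(\sigma[x\mapsto v])$; $P\preceq Q$ iff $P(\sigma)\le Q(\sigma)$ for all $\sigma$; $[B](\sigma)=+\infty$ if $B$ holds in $\sigma$, else $-\infty$. $\mathrm{fv}$ = free variables, $\mathrm{mod}(C)$ = variables modified by $C$. Semantics: $\vDash_{\mathsf F}[P]C[Q]$ iff for all $\tau$ and $q\ge Q(\tau)$ there exist $\sigma$, $p\ge P(\sigma)$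 with $\langle C,\sigma,p\rangle\Downarrow\langle\tau,q\rangle$. $\vDash_{\mathsf B}[P]C[Q]$ iff for all $\sigma$ and $p\le P(\sigma)$ there exist $\tau$, $q\le Q(\tau)$ with $\langle C,\sigma,p\rangle\Downarrow\langle\tau,q\rangle$. QFUA rules ($\vdash_{\mathsf F}$): $[P]\mathsf{skip}[P]$; $[P]\,x:=e\,[\mathsf{Inf}\,x'.\max(P[x'/x],[x\ne e[x'/x]])]$; $[\max(P,[\neg B])]\mathsf{assume}(B)[\max(P,[\neg B])]$; $[P]\mathsf{tick}(e)[P-e]$; from $[P]C_1[R]$, $[R]C_2[Q]$ get $[P]C_1;C_2[Q]$; from $[P]C_i[Q]$ ($i=1$ or $2$) get $[P]C_1+C_2[Q]$; from $\forall n<k.[P(n)]C[P(n+1)]$ get $[P(0)]C^\star[P(k)]$; from $[P]C[Q]$ get $[\mathsf{Inf}\,x.P]\mathsf{local}\ x\ \mathsf{in}\ C[\mathsf{Inf}\,x.Q]$; from $\forall i\in I.[P_i]C[Q_i]$ get $[\lambda\sigma.\inf_{i\in I}P_i(\sigma)]C[\lambda\sigma.\inf_{i\in I}Q_i(\sigma)]$; if $[P]C[Q]$ and $\mathrm{fv}(B)\cap\mathrm{mod}(C)=\emptyset$ then $[\max(P,[B])]C[\max(Q,[B])]$; if $[P]C[Q]$ and $\mathrm{fv}(F)\cap\mathrm{mod}(C)=\emptyset$ then $[P+F]C[Q+F]$; if $P\preceq P'$, $[P']C[Q']$, $Q'\preceq Q$ then $[P]C[Q]$; if $[P]C[Q]$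 and $y\notin\mathrm{fv}(P)\cup\mathrm{fv}(Q)\cup\mathrm{fv}(C)$ then $[P[y/x]]C[y/x][Q[y/x]]$. QBUA rules ($\vdash_{\mathsf B}$): identical skip, tick, seq, choice, loop, relax, consequence ($P\preceq P'$, $[P']C[Q']$, $Q'\preceq Q$ gives $[P]C[Q]$) and substitution rules, but with: $[P]\,x:=e\,[\mathsf{Sup}\,x'.\min(P[x'/x],[x=e[x'/x]])]$; $[\min(P,[B])]\mathsf{assume}(B)[\min(P,[B])]$; local: $[\mathsf{Sup}\,x.P]\mathsf{local}\ x\ \mathsf{in}\ C[\mathsf{Sup}\,x.Q]$; disjunction: from $\forall i\in I.[P_i]C[Q_i]$ get $[\lambda\sigma.\sup_{i\in I}P_i(\sigma)]C[\lambda\sigma.\sup_{i\in I}Q_i(\sigma)]$; constancy: $[\min(P,[B])]C[\min(Q,[B])]$. -}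

module Defs where

open import Data.Nat using (ℕ; zero; suc) renaming (_<_ to _<ℕ_; _≟_ to _≟ℕ_)
open import Data.Integer as ℤ using (ℤ)
open import Data.Bool using (Bool; true; false; if_then_else_; not; _∧_; _∨_)
open import Data.Product using (Σ; ∃; ∃-syntax; _×_; _,_)
open import Data.Sum using (_⊎_)
open import Data.Empty using (⊥)
open import Relation.Nullary using (¬_; does)
open import Relation.Binary.PropositionalEquality using (_≡_; _≢_)

Var : Set
Var = ℕ

State : Set
State = Var → ℤ

_[_↦_] : State → Var → ℤ → State
(σ [ x ↦ v ]) y = if does (y ≟ℕ x) then v else σ y

infixl 6 _⊕_ _⊖_
infixl 7 _⊗_
data AExp : Set where
  num : ℤ → AExp
  var : Var → AExp
  _⊕_ _⊖_ _⊗_ : AExp → AExp → AExp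

data BExp : Set where
  btrue bfalse : BExp
  bnot : BExp → BExp
  band bor : BExp → BExp → BExp
  _≤ₑ_ _<ₑ_ _=ₑ_ : AExp → AExp → BExp

⟦_⟧ : AExp → State → ℤ
⟦ num n ⟧ σ = n
⟦ var x ⟧ σ = σ x
⟦ a ⊕ b ⟧ σ = ⟦ a ⟧ σ ℤ.+ ⟦ b ⟧ σ
⟦ a ⊖ b ⟧ σ = ⟦ a ⟧ σ ℤ.- ⟦ b ⟧ σ
⟦ a ⊗ b ⟧ σ = ⟦ a ⟧ σ ℤ.* ⟦ b ⟧ σ

⟦_⟧B : BExp → State → Bool
⟦ btrue ⟧B σ = true
⟦ bfalse ⟧B σ = false
⟦ bnot b ⟧B σ = not (⟦ b ⟧B σ)
⟦ band b c ⟧B σ = ⟦ b ⟧B σ ∧ ⟦ c ⟧B σ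
⟦ bor b c ⟧B σ = ⟦ b ⟧B σ ∨ ⟦ c ⟧B σ
⟦ a ≤ₑ b ⟧B σ = does (⟦ a ⟧ σ ℤ.≤? ⟦ b ⟧ σ)
⟦ a <ₑ b ⟧B σ = does (⟦ a ⟧ σ ℤ.<? ⟦ b ⟧ σ)
⟦ a =ₑ b ⟧B σ = does (⟦ a ⟧ σ ℤ.≟ ⟦ b ⟧ σ)

infixr 4 _⨾_
infixr 3 _⊹_
infix 5 _≔_
infix 6 _⋆
data Cmd : Set where
  skip : Cmd
  _≔_ : Var → AExp → Cmd
  assume : BExp → Cmd
  tick : AExp → Cmd
  _⨾_ : Cmd → Cmd → Cmd
  _⊹_ : Cmd → Cmd → Cmd
  _⋆ : Cmd → Cmd
  local_∙_ : Var → Cmd → Cmd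

-- Big-step semantics:  Run C σ p l τ q  is  ⟨C,σ,p⟩ ⇓_l ⟨τ,q⟩

data Run : Cmd → State → ℤ → ℤ → State → ℤ → Set where
  r-skip   : ∀ {σ p} → Run skip σ p p σ p
  r-assign : ∀ {x e σ p} → Run (x ≔ e) σ p p (σ [ x ↦ ⟦ e ⟧ σ ]) p
  r-assume : ∀ {B σ p} → ⟦ B ⟧B σ ≡ true → Run (assume B) σ p p σ p
  r-tick   : ∀ {e σ p} →
             Run (tick e) σ p (p ℤ.⊓ (p ℤ.- ⟦ e ⟧ σ)) σ (p ℤ.- ⟦ e ⟧ σ)
  r-seq    : ∀ {C₁ C₂ σ p l₁ ρ r l₂ τ q} →
             Run C₁ σ p l₁ ρ r → Run C₂ ρ r l₂ τ q →
             Run (C₁ ⨾ C₂) σ p (l₁ ℤ.⊓ l₂) τ q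
  r-choiceˡ : ∀ {C₁ C₂ σ p l τ q} → Run C₁ σ p l τ q → Run (C₁ ⊹ C₂) σ p l τ q
  r-choiceʳ : ∀ {C₁ C₂ σ p l τ q} → Run C₂ σ p l τ q → Run (C₁ ⊹ C₂) σ p l τ q
  r-loop0  : ∀ {C σ p} → Run (C ⋆) σ p p σ p
  r-loopS  : ∀ {C σ p l τ q} → Run (C ⨾ (C ⋆)) σ p l τ q → Run (C ⋆) σ p l τ q
  r-local  : ∀ {x C σ p l τ q v} → Run C σ p l τ q →
             Run (local x ∙ C) (σ [ x ↦ v ]) p l (τ [ x ↦ v ]) q

_,_,_⇓_,_ : Cmd → State → ℤ → State → ℤ → Set
C , σ , p ⇓ τ , q = ∃[ l ] Run C σ p l τ q

data ℤ∞ : Set where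
  -∞ : ℤ∞
  fin : ℤ → ℤ∞
  +∞ : ℤ∞

infix 4 _≤∞_
data _≤∞_ : ℤ∞ → ℤ∞ → Set where
  -∞≤   : ∀ {a} → -∞ ≤∞ a
  fin≤  : ∀ {m n} → m ℤ.≤ n → fin m ≤∞ fin n
  ≤+∞   : ∀ {a} → a ≤∞ +∞

max∞ : ℤ∞ → ℤ∞ → ℤ∞
max∞ -∞ b = b
max∞ +∞ b = +∞
max∞ (fin m) -∞ = fin m
max∞ (fin m) (fin n) = fin (m ℤ.⊔ n)
max∞ (fin m) +∞ = +∞

min∞ : ℤ∞ → ℤ∞ → ℤ∞
min∞ -∞ b = -∞
min∞ +∞ b = b
min∞ (fin m) -∞ = -∞
min∞ (fin m) (fin n) = fin (m ℤ.⊓ n)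
min∞ (fin m) +∞ = fin m

-- addition with +∞ absorbing (+∞ + -∞ = +∞); used in the QFUA relax rule
_+⊤_ : ℤ∞ → ℤ∞ → ℤ∞
+∞ +⊤ b = +∞
-∞ +⊤ +∞ = +∞
-∞ +⊤ -∞ = -∞
-∞ +⊤ fin n = -∞
fin m +⊤ +∞ = +∞
fin m +⊤ -∞ = -∞
fin m +⊤ fin n = fin (m ℤ.+ n)

-- addition with -∞ absorbing (+∞ + -∞ = -∞); used in the QBUA relax rule
_+⊥_ : ℤ∞ → ℤ∞ → ℤ∞
-∞ +⊥ b = -∞
+∞ +⊥ -∞ = -∞
+∞ +⊥ +∞ = +∞
+∞ +⊥ fin n = +∞
fin m +⊥ -∞ = -∞
fin m +⊥ +∞ = +∞
fin m +⊥ fin n = fin (m ℤ.+ n)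

_-∞ℤ_ : ℤ∞ → ℤ → ℤ∞
-∞ -∞ℤ n = -∞
fin m -∞ℤ n = fin (m ℤ.- n)
+∞ -∞ℤ n = +∞

LowerBound : {I : Set} → ℤ∞ → (I → ℤ∞) → Set
LowerBound r f = ∀ i → r ≤∞ f i

UpperBound : {I : Set} → ℤ∞ → (I → ℤ∞) → Set
UpperBound r f = ∀ i → f i ≤∞ r

IsInf : {I : Set} → ℤ∞ → (I → ℤ∞) → Set
IsInf r f = LowerBound r f × (∀ r' → LowerBound r' f → r' ≤∞ r)

IsSup : {I : Set} → ℤ∞ → (I → ℤ∞) → Set
IsSup r f = UpperBound r f × (∀ r' → UpperBound r' f → r ≤∞ r')

ResFn : Set
ResFn = State → ℤ∞

_⪯_ : ResFn → ResFn → Set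
P ⪯ Q = ∀ σ → P σ ≤∞ Q σ

maxR minR : ResFn → ResFn → ResFn
maxR P Q σ = max∞ (P σ) (Q σ)
minR P Q σ = min∞ (P σ) (Q σ)

_+⊤R_ _+⊥R_ : ResFn → ResFn → ResFn
(P +⊤R F) σ = P σ +⊤ F σ
(P +⊥R F) σ = P σ +⊥ F σ

_-R_ : ResFn → AExp → ResFn
(P -R e) σ = P σ -∞ℤ ⟦ e ⟧ σ

⟪_⟫ : BExp → ResFn
⟪ B ⟫ σ = if ⟦ B ⟧B σ then +∞ else -∞

IsInfX : Var → ResFn → ResFn → Set
IsInfX x P R = ∀ σ → IsInf (R σ) (λ (v : ℤ) → P (σ [ x ↦ v ]))

IsSupX : Var → ResFn → ResFn → Set
IsSupX x P R = ∀ σ → IsSup (R σ) (λ (v : ℤ) → P (σ [ x ↦ v ]))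

_[_/_]R : ResFn → Var → Var → ResFn
(P [ y / x ]R) σ = P (σ [ x ↦ σ y ])

NotFreeR : Var → ResFn → Set
NotFreeR x P = ∀ σ v → P (σ [ x ↦ v ]) ≡ P σ

FvA : Var → AExp → Set
FvA x (num n) = ⊥
FvA x (var y) = x ≡ y
FvA x (a ⊕ b) = FvA x a ⊎ FvA x b
FvA x (a ⊖ b) = FvA x a ⊎ FvA x b
FvA x (a ⊗ b) = FvA x a ⊎ FvA x b

FvB : Var → BExp → Set
FvB x btrue = ⊥
FvB x bfalse = ⊥
FvB x (bnot b) = FvB x b
FvB x (band b c) = FvB x b ⊎ FvB x c
FvB x (bor b c) = FvB x b ⊎ FvB x c
FvB x (a ≤ₑ b) = FvA x a ⊎ FvA x b
FvB x (a <ₑ b) = FvA x a ⊎ FvA x b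
FvB x (a =ₑ b) = FvA x a ⊎ FvA x b

Mod : Var → Cmd → Set
Mod x skip = ⊥
Mod x (y ≔ e) = x ≡ y
Mod x (assume B) = ⊥
Mod x (tick e) = ⊥
Mod x (C₁ ⨾ C₂) = Mod x C₁ ⊎ Mod x C₂
Mod x (C₁ ⊹ C₂) = Mod x C₁ ⊎ Mod x C₂
Mod x (C ⋆) = Mod x C
Mod x (local y ∙ C) = x ≢ y × Mod x C

OccC : Var → Cmd → Set
OccC x skip = ⊥
OccC x (y ≔ e) = x ≡ y ⊎ FvA x e
OccC x (assume B) = FvB x B
OccC x (tick e) = FvA x e
OccC x (C₁ ⨾ C₂) = OccC x C₁ ⊎ OccC x C₂
OccC x (C₁ ⊹ C₂) = OccC x C₁ ⊎ OccC x C₂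
OccC x (C ⋆) = OccC x C
OccC x (local y ∙ C) = x ≡ y ⊎ OccC x C

renV : Var → Var → Var → Var
renV y x z = if does (z ≟ℕ x) then y else z

renA : Var → Var → AExp → AExp
renA y x (num n) = num n
renA y x (var z) = var (renV y x z)
renA y x (a ⊕ b) = renA y x a ⊕ renA y x b
renA y x (a ⊖ b) = renA y x a ⊖ renA y x b
renA y x (a ⊗ b) = renA y x a ⊗ renA y x b

renB : Var → Var → BExp → BExp
renB y x btrue = btrue
renB y x bfalse = bfalse
renB y x (bnot b) = bnot (renB y x b)
renB y x (band b c) = band (renB y x b) (renB y x c)
renB y x (bor b c) = bor (renB y x b) (renB y x c)
renB y x (a ≤ₑ b) = renA y x a ≤ₑ renA y x b
renB y x (a <ₑ b) = renA y x a <ₑ renA y x b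
renB y x (a =ₑ b) = renA y x a =ₑ renA y x b

renC : Var → Var → Cmd → Cmd
renC y x skip = skip
renC y x (z ≔ e) = renV y x z ≔ renA y x e
renC y x (assume B) = assume (renB y x B)
renC y x (tick e) = tick (renA y x e)
renC y x (C₁ ⨾ C₂) = renC y x C₁ ⨾ renC y x C₂
renC y x (C₁ ⊹ C₂) = renC y x C₁ ⊹ renC y x C₂
renC y x (C ⋆) = renC y x C ⋆
renC y x (local z ∙ C) = local (renV y x z) ∙ renC y x C

⊨F[_]_[_] : ResFn → Cmd → ResFn → Set
⊨F[ P ] C [ Q ] = ∀ τ (q : ℤ) → Q τ ≤∞ fin q →
  ∃[ σ ] ∃[ p ] (P σ ≤∞ fin p × C , σ , p ⇓ τ , q)

⊨B[_]_[_] : ResFn → Cmd → ResFn → Set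
⊨B[ P ] C [ Q ] = ∀ σ (p : ℤ) → fin p ≤∞ P σ →
  ∃[ τ ] ∃[ q ] (fin q ≤∞ Q τ × C , σ , p ⇓ τ , q)

data ⊢F[_]_[_] : ResFn → Cmd → ResFn → Set₁ where
  F-skip : ∀ {P} → ⊢F[ P ] skip [ P ]
  -- x' is the bound variable of Inf x'. …, chosen fresh
  F-assign : ∀ {P Q x x' e} → x' ≢ x → NotFreeR x' P → ¬ FvA x' e →
    IsInfX x' (λ σ → max∞ ((P [ x' / x ]R) σ) (⟪ bnot (var x =ₑ renA x' x e) ⟫ σ)) Q →
    ⊢F[ P ] x ≔ e [ Q ]
  F-assume : ∀ {P B} →
    ⊢F[ maxR P ⟪ bnot B ⟫ ] assume B [ maxR P ⟪ bnot B ⟫ ]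
  F-tick : ∀ {P e} → ⊢F[ P ] tick e [ P -R e ]
  F-seq : ∀ {P R Q C₁ C₂} → ⊢F[ P ] C₁ [ R ] → ⊢F[ R ] C₂ [ Q ] →
    ⊢F[ P ] C₁ ⨾ C₂ [ Q ]
  F-choiceˡ : ∀ {P Q C₁ C₂} → ⊢F[ P ] C₁ [ Q ] → ⊢F[ P ] C₁ ⊹ C₂ [ Q ]
  F-choiceʳ : ∀ {P Q C₁ C₂} → ⊢F[ P ] C₂ [ Q ] → ⊢F[ P ] C₁ ⊹ C₂ [ Q ]
  F-loop : ∀ {C} (P : ℕ → ResFn) (k : ℕ) →
    (∀ n → n <ℕ k → ⊢F[ P n ] C [ P (suc n) ]) →
    ⊢F[ P 0 ] C ⋆ [ P k ]
  F-local : ∀ {P Q P' Q' x C} → ⊢F[ P ] C [ Q ] →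
    IsInfX x P P' → IsInfX x Q Q' → ⊢F[ P' ] local x ∙ C [ Q' ]
  F-conj : ∀ {C P Q} (I : Set) (Ps Qs : I → ResFn) →
    (∀ i → ⊢F[ Ps i ] C [ Qs i ]) →
    (∀ σ → IsInf (P σ) (λ i → Ps i σ)) →
    (∀ σ → IsInf (Q σ) (λ i → Qs i σ)) →
    ⊢F[ P ] C [ Q ]
  F-constancy : ∀ {P Q C B} → ⊢F[ P ] C [ Q ] →
    (∀ x → FvB x B → ¬ Mod x C) →
    ⊢F[ maxR P ⟪ B ⟫ ] C [ maxR Q ⟪ B ⟫ ]
  F-relax : ∀ {P Q C F} → ⊢F[ P ] C [ Q ] →
    (∀ x → Mod x C → NotFreeR x F) →
    ⊢F[ P +⊤R F ] C [ Q +⊤R F ]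
  F-conseq : ∀ {P P' Q Q' C} → P ⪯ P' → ⊢F[ P' ] C [ Q' ] → Q' ⪯ Q →
    ⊢F[ P ] C [ Q ]
  F-subst : ∀ {P Q C x y} → ⊢F[ P ] C [ Q ] →
    NotFreeR y P → NotFreeR y Q → ¬ OccC y C →
    ⊢F[ P [ y / x ]R ] renC y x C [ Q [ y / x ]R ]

data ⊢B[_]_[_] : ResFn → Cmd → ResFn → Set₁ where
  B-skip : ∀ {P} → ⊢B[ P ] skip [ P ]
  B-assign : ∀ {P Q x x' e} → x' ≢ x → NotFreeR x' P → ¬ FvA x' e →
    IsSupX x' (λ σ → min∞ ((P [ x' / x ]R) σ) (⟪ var x =ₑ renA x' x e ⟫ σ)) Q →
    ⊢B[ P ] x ≔ e [ Q ]
  B-assume : ∀ {P B} →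
    ⊢B[ minR P ⟪ B ⟫ ] assume B [ minR P ⟪ B ⟫ ]
  B-tick : ∀ {P e} → ⊢B[ P ] tick e [ P -R e ]
  B-seq : ∀ {P R Q C₁ C₂} → ⊢B[ P ] C₁ [ R ] → ⊢B[ R ] C₂ [ Q ] →
    ⊢B[ P ] C₁ ⨾ C₂ [ Q ]
  B-choiceˡ : ∀ {P Q C₁ C₂} → ⊢B[ P ] C₁ [ Q ] → ⊢B[ P ] C₁ ⊹ C₂ [ Q ]
  B-choiceʳ : ∀ {P Q C₁ C₂} → ⊢B[ P ] C₂ [ Q ] → ⊢B[ P ] C₁ ⊹ C₂ [ Q ]
  B-loop : ∀ {C} (P : ℕ → ResFn) (k : ℕ) →
    (∀ n → n <ℕ k → ⊢B[ P n ] C [ P (suc n) ]) →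
    ⊢B[ P 0 ] C ⋆ [ P k ]
  B-local : ∀ {P Q P' Q' x C} → ⊢B[ P ] C [ Q ] →
    IsSupX x P P' → IsSupX x Q Q' → ⊢B[ P' ] local x ∙ C [ Q' ]
  B-disj : ∀ {C P Q} (I : Set) (Ps Qs : I → ResFn) →
    (∀ i → ⊢B[ Ps i ] C [ Qs i ]) →
    (∀ σ → IsSup (P σ) (λ i → Ps i σ)) →
    (∀ σ → IsSup (Q σ) (λ i → Qs i σ)) →
    ⊢B[ P ] C [ Q ]
  B-constancy : ∀ {P Q C B} → ⊢B[ P ] C [ Q ] →
    (∀ x → FvB x B → ¬ Mod x C) →
    ⊢B[ minR P ⟪ B ⟫ ] C [ minR Q ⟪ B ⟫ ]
  B-relax : ∀ {P Q C F} → ⊢B[ P ] C [ Q ] →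
    (∀ x → Mod x C → NotFreeR x F) →
    ⊢B[ P +⊥R F ] C [ Q +⊥R F ]
  B-conseq : ∀ {P P' Q Q' C} → P ⪯ P' → ⊢B[ P' ] C [ Q' ] → Q' ⪯ Q →
    ⊢B[ P ] C [ Q ]
  B-subst : ∀ {P Q C x y} → ⊢B[ P ] C [ Q ] →
    NotFreeR y P → NotFreeR y Q → ¬ OccC y C →
    ⊢B[ P [ y / x ]R ] renC y x C [ Q [ y / x ]R ]

-- Soundness is proved rule by rule: forward triples are validated backwards from the final
-- state and resource, backward triples forwards from the initial ones.  Three facts about runs
-- carry the non-structural rules: a run can be shifted by any constant amount of resource
-- (relax); a run preserves every quantity depending only on unmodified variables (constancy,
-- relax); and a run of C yields a run of C[y/x] between the states in which the fresh y holds the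
-- value of x (substitution).  The rules built from infima and suprema (assignment, local,
-- conjunction, disjunction) need a member of the family below (resp. above) a given integer
-- bound: otherwise its successor (resp. predecessor) would bound the family, and excluded middle
-- turns this into a witness.
module Submission where

open import Defs
open import Level using (0ℓ)
open import Data.Product using (_×_; _,_; proj₁; proj₂; ∃-syntax)
open import Axiom.Extensionality.Propositional using (Extensionality)
open import Axiom.ExcludedMiddle using (ExcludedMiddle)
open import Data.Nat using (ℕ; zero; suc; _≡ᵇ_) renaming (_<_ to _<ℕ_; _≟_ to _≟ℕ_)
import Data.Nat.Properties as ℕP
open import Data.Bool using (true; false; not; _∧_; _∨_)
open import Data.Bool.Properties using (not-injective)
open import Function using (_∘_)
open import Data.Integer as ℤ using (ℤ)
import Data.Integer.Properties as ℤP
open import Data.Integer.Tactic.RingSolver using (solve-∀)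
open import Data.Sum using (inj₁; inj₂)
open import Data.Empty using (⊥-elim)
open import Relation.Nullary using (¬_; yes; no; does)
open import Relation.Nullary.Decidable using (dec-true; dec-false)
open import Relation.Binary.PropositionalEquality

update-same : ∀ (σ : State) x v → (σ [ x ↦ v ]) x ≡ v
update-same σ x v rewrite dec-true (x ≟ℕ x) refl = refl

update-other : ∀ (σ : State) x v {u} → u ≢ x → (σ [ x ↦ v ]) u ≡ σ u
update-other σ x v {u} u≢x rewrite dec-false (u ≟ℕ x) u≢x = refl

renV-same : ∀ y x → renV y x x ≡ y
renV-same y x rewrite dec-true (x ≟ℕ x) refl = refl

renV-other : ∀ y x {z} → z ≢ x → renV y x z ≡ z
renV-other y x {z} z≢x rewrite dec-false (z ≟ℕ x) z≢x = refl

⟦⟧-cong : ∀ e {σ ρ : State} → (∀ z → FvA z e → σ z ≡ ρ z) → ⟦ e ⟧ σ ≡ ⟦ e ⟧ ρ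
⟦⟧-cong (num n) h = refl
⟦⟧-cong (var y) h = h y refl
⟦⟧-cong (a ⊕ b) h = cong₂ ℤ._+_ (⟦⟧-cong a (λ z → h z ∘ inj₁)) (⟦⟧-cong b (λ z → h z ∘ inj₂))
⟦⟧-cong (a ⊖ b) h = cong₂ ℤ._-_ (⟦⟧-cong a (λ z → h z ∘ inj₁)) (⟦⟧-cong b (λ z → h z ∘ inj₂))
⟦⟧-cong (a ⊗ b) h = cong₂ ℤ._*_ (⟦⟧-cong a (λ z → h z ∘ inj₁)) (⟦⟧-cong b (λ z → h z ∘ inj₂))

⟦⟧B-cong : ∀ B {σ ρ : State} → (∀ z → FvB z B → σ z ≡ ρ z) → ⟦ B ⟧B σ ≡ ⟦ B ⟧B ρ
⟦⟧B-cong btrue h = refl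
⟦⟧B-cong bfalse h = refl
⟦⟧B-cong (bnot b) h = cong not (⟦⟧B-cong b h)
⟦⟧B-cong (band b c) h = cong₂ _∧_ (⟦⟧B-cong b (λ z → h z ∘ inj₁)) (⟦⟧B-cong c (λ z → h z ∘ inj₂))
⟦⟧B-cong (bor b c) h = cong₂ _∨_ (⟦⟧B-cong b (λ z → h z ∘ inj₁)) (⟦⟧B-cong c (λ z → h z ∘ inj₂))
⟦⟧B-cong (a ≤ₑ b) h =
  cong₂ (λ u v → does (u ℤ.≤? v)) (⟦⟧-cong a (λ z → h z ∘ inj₁)) (⟦⟧-cong b (λ z → h z ∘ inj₂))
⟦⟧B-cong (a <ₑ b) h =
  cong₂ (λ u v → does (u ℤ.<? v)) (⟦⟧-cong a (λ z → h z ∘ inj₁)) (⟦⟧-cong b (λ z → h z ∘ inj₂))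
⟦⟧B-cong (a =ₑ b) h =
  cong₂ (λ u v → does (u ℤ.≟ v)) (⟦⟧-cong a (λ z → h z ∘ inj₁)) (⟦⟧-cong b (λ z → h z ∘ inj₂))

⟦⟧-update-fresh : ∀ e {x} → ¬ FvA x e → ∀ (σ : State) v → ⟦ e ⟧ (σ [ x ↦ v ]) ≡ ⟦ e ⟧ σ
⟦⟧-update-fresh e {x} x∉e σ v =
  ⟦⟧-cong e (λ z z∈e → update-other σ x v (λ z≡x → x∉e (subst (λ t → FvA t e) z≡x z∈e)))

⟦⟧B-update-fresh : ∀ B {x} → ¬ FvB x B → ∀ (σ : State) v → ⟦ B ⟧B (σ [ x ↦ v ]) ≡ ⟦ B ⟧B σ
⟦⟧B-update-fresh B {x} x∉B σ v =
  ⟦⟧B-cong B (λ z z∈B → update-other σ x v (λ z≡x → x∉B (subst (λ t → FvB t B) z≡x z∈B)))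

⟦renA⟧ : ∀ y x e (σ : State) → ⟦ renA y x e ⟧ σ ≡ ⟦ e ⟧ (σ [ x ↦ σ y ])
⟦renA⟧ y x (num n) σ = refl
⟦renA⟧ y x (var z) σ with z ≡ᵇ x
... | true = refl
... | false = refl
⟦renA⟧ y x (a ⊕ b) σ = cong₂ ℤ._+_ (⟦renA⟧ y x a σ) (⟦renA⟧ y x b σ)
⟦renA⟧ y x (a ⊖ b) σ = cong₂ ℤ._-_ (⟦renA⟧ y x a σ) (⟦renA⟧ y x b σ)
⟦renA⟧ y x (a ⊗ b) σ = cong₂ ℤ._*_ (⟦renA⟧ y x a σ) (⟦renA⟧ y x b σ)

⟦renB⟧ : ∀ y x B (σ : State) → ⟦ renB y x B ⟧B σ ≡ ⟦ B ⟧B (σ [ x ↦ σ y ])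
⟦renB⟧ y x btrue σ = refl
⟦renB⟧ y x bfalse σ = refl
⟦renB⟧ y x (bnot b) σ = cong not (⟦renB⟧ y x b σ)
⟦renB⟧ y x (band b c) σ = cong₂ _∧_ (⟦renB⟧ y x b σ) (⟦renB⟧ y x c σ)
⟦renB⟧ y x (bor b c) σ = cong₂ _∨_ (⟦renB⟧ y x b σ) (⟦renB⟧ y x c σ)
⟦renB⟧ y x (a ≤ₑ b) σ = cong₂ (λ u v → does (u ℤ.≤? v)) (⟦renA⟧ y x a σ) (⟦renA⟧ y x b σ)
⟦renB⟧ y x (a <ₑ b) σ = cong₂ (λ u v → does (u ℤ.<? v)) (⟦renA⟧ y x a σ) (⟦renA⟧ y x b σ)
⟦renB⟧ y x (a =ₑ b) σ = cong₂ (λ u v → does (u ℤ.≟ v)) (⟦renA⟧ y x a σ) (⟦renA⟧ y x b σ)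

[i-j]+j≡i : ∀ (i j : ℤ) → (i ℤ.- j) ℤ.+ j ≡ i
[i-j]+j≡i = solve-∀

[i+j]-j≡i : ∀ (i j : ℤ) → (i ℤ.+ j) ℤ.- j ≡ i
[i+j]-j≡i = solve-∀

[i+k]-j≡[i-j]+k : ∀ (i k j : ℤ) → (i ℤ.+ k) ℤ.- j ≡ (i ℤ.- j) ℤ.+ k
[i+k]-j≡[i-j]+k = solve-∀

i-[i-j]≡j : ∀ (i j : ℤ) → i ℤ.- (i ℤ.- j) ≡ j
i-[i-j]≡j = solve-∀

≤∞-trans : ∀ {a b c} → a ≤∞ b → b ≤∞ c → a ≤∞ c
≤∞-trans -∞≤ _ = -∞≤
≤∞-trans (fin≤ p) (fin≤ q) = fin≤ (ℤP.≤-trans p q)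
≤∞-trans (fin≤ p) ≤+∞ = ≤+∞
≤∞-trans ≤+∞ ≤+∞ = ≤+∞

max∞-≤-inv : ∀ a b {q} → max∞ a b ≤∞ fin q → a ≤∞ fin q × b ≤∞ fin q
max∞-≤-inv -∞ b h = -∞≤ , h
max∞-≤-inv (fin m) -∞ h = h , -∞≤
max∞-≤-inv (fin m) (fin n) (fin≤ le) =
  fin≤ (ℤP.≤-trans (ℤP.i≤i⊔j m n) le) , fin≤ (ℤP.≤-trans (ℤP.i≤j⊔i m n) le)

min∞-≥-inv : ∀ a b {p} → fin p ≤∞ min∞ a b → fin p ≤∞ a × fin p ≤∞ b
min∞-≥-inv (fin m) (fin n) (fin≤ le) =
  fin≤ (ℤP.≤-trans le (ℤP.i⊓j≤i m n)) , fin≤ (ℤP.≤-trans le (ℤP.i⊓j≤j m n))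
min∞-≥-inv (fin m) +∞ h = h , ≤+∞
min∞-≥-inv +∞ b h = ≤+∞ , h

min∞-glb : ∀ {a b p} → fin p ≤∞ a → fin p ≤∞ b → fin p ≤∞ min∞ a b
min∞-glb (fin≤ x) (fin≤ y) = fin≤ (ℤP.⊓-glb x y)
min∞-glb (fin≤ x) ≤+∞ = fin≤ x
min∞-glb ≤+∞ h = h

fin≤⇒fin≤-∞ℤ : ∀ a k {p} → fin p ≤∞ a → fin (p ℤ.- k) ≤∞ a -∞ℤ k
fin≤⇒fin≤-∞ℤ (fin m) k (fin≤ le) = fin≤ (ℤP.+-monoˡ-≤ (ℤ.- k) le)
fin≤⇒fin≤-∞ℤ +∞ k h = ≤+∞

-∞ℤ≤fin⇒≤fin : ∀ a k q → a -∞ℤ k ≤∞ fin q → a ≤∞ fin (q ℤ.+ k)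
-∞ℤ≤fin⇒≤fin -∞ k q h = -∞≤
-∞ℤ≤fin⇒≤fin (fin m) k q (fin≤ le) = fin≤ (subst (ℤ._≤ q ℤ.+ k) ([i-j]+j≡i m k) (ℤP.+-monoˡ-≤ k le))

⟪⟫≤fin⇒false : ∀ B σ {q} → ⟪ B ⟫ σ ≤∞ fin q → ⟦ B ⟧B σ ≡ false
⟪⟫≤fin⇒false B σ h with ⟦ B ⟧B σ
⟪⟫≤fin⇒false B σ () | true
... | false = refl

fin≤⟪⟫⇒true : ∀ B σ {p} → fin p ≤∞ ⟪ B ⟫ σ → ⟦ B ⟧B σ ≡ true
fin≤⟪⟫⇒true B σ h with ⟦ B ⟧B σ
fin≤⟪⟫⇒true B σ () | false
... | true = refl

⟪≢⟫≤fin⇒≡ : ∀ a b σ {q} → ⟪ bnot (a =ₑ b) ⟫ σ ≤∞ fin q → ⟦ a ⟧ σ ≡ ⟦ b ⟧ σ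
⟪≢⟫≤fin⇒≡ a b σ h with ⟦ a ⟧ σ ℤ.≟ ⟦ b ⟧ σ
... | yes a≡b = a≡b
⟪≢⟫≤fin⇒≡ a b σ () | no _

≡⇒fin≤⟪≡⟫ : ∀ a b σ {p} → ⟦ a ⟧ σ ≡ ⟦ b ⟧ σ → fin p ≤∞ ⟪ a =ₑ b ⟫ σ
≡⇒fin≤⟪≡⟫ a b σ a≡b with ⟦ a ⟧ σ ℤ.≟ ⟦ b ⟧ σ
... | yes _ = ≤+∞
... | no a≢b = ⊥-elim (a≢b a≡b)

max∞-⟪false⟫ : ∀ a B σ → ⟦ B ⟧B σ ≡ false → max∞ a (⟪ B ⟫ σ) ≡ a
max∞-⟪false⟫ -∞ B σ eq rewrite eq = refl
max∞-⟪false⟫ (fin m) B σ eq rewrite eq = refl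
max∞-⟪false⟫ +∞ B σ eq = refl

min∞-⟪true⟫ : ∀ a B σ → ⟦ B ⟧B σ ≡ true → min∞ a (⟪ B ⟫ σ) ≡ a
min∞-⟪true⟫ -∞ B σ eq = refl
min∞-⟪true⟫ (fin m) B σ eq rewrite eq = refl
min∞-⟪true⟫ +∞ B σ eq rewrite eq = refl

+⊤-≤fin-split : ∀ a b q → a +⊤ b ≤∞ fin q →
  ∃[ d ] (a ≤∞ fin (q ℤ.- d) × (∀ c p → c ≤∞ fin p → c +⊤ b ≤∞ fin (p ℤ.+ d)))
+⊤-≤fin-split -∞ -∞ q h = ℤ.0ℤ , -∞≤ , λ { -∞ p _ → -∞≤ ; (fin c) p _ → -∞≤ }
+⊤-≤fin-split -∞ (fin f) q h =
  f , -∞≤ , λ { -∞ p _ → -∞≤ ; (fin c) p (fin≤ le) → fin≤ (ℤP.+-monoˡ-≤ f le) }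
+⊤-≤fin-split (fin m) -∞ q h =
  q ℤ.- m , fin≤ (ℤP.≤-reflexive (sym (i-[i-j]≡j q m))) , λ { -∞ p _ → -∞≤ ; (fin c) p _ → -∞≤ }
+⊤-≤fin-split (fin m) (fin f) q (fin≤ le) =
  f , fin≤ (subst (ℤ._≤ q ℤ.- f) ([i+j]-j≡i m f) (ℤP.+-monoˡ-≤ (ℤ.- f) le)) ,
  λ { -∞ p _ → -∞≤ ; (fin c) p (fin≤ le′) → fin≤ (ℤP.+-monoˡ-≤ f le′) }

+⊥-fin≤-split : ∀ a b p → fin p ≤∞ a +⊥ b →
  ∃[ d ] (fin (p ℤ.- d) ≤∞ a × (∀ c q → fin q ≤∞ c → fin (q ℤ.+ d) ≤∞ c +⊥ b))
+⊥-fin≤-split +∞ +∞ p h = ℤ.0ℤ , ≤+∞ , λ { (fin c) q _ → ≤+∞ ; +∞ q _ → ≤+∞ }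
+⊥-fin≤-split +∞ (fin f) p h =
  f , ≤+∞ , λ { (fin c) q (fin≤ le) → fin≤ (ℤP.+-monoˡ-≤ f le) ; +∞ q _ → ≤+∞ }
+⊥-fin≤-split (fin m) +∞ p h =
  p ℤ.- m , fin≤ (ℤP.≤-reflexive (i-[i-j]≡j p m)) , λ { (fin c) q _ → ≤+∞ ; +∞ q _ → ≤+∞ }
+⊥-fin≤-split (fin m) (fin f) p (fin≤ le) =
  f , fin≤ (subst (p ℤ.- f ℤ.≤_) ([i+j]-j≡i m f) (ℤP.+-monoˡ-≤ (ℤ.- f) le)) ,
  λ { (fin c) q (fin≤ le′) → fin≤ (ℤP.+-monoˡ-≤ f le′) ; +∞ q _ → ≤+∞ }

≰fin⇒suc≤ : ∀ a {q} → ¬ (a ≤∞ fin q) → fin (ℤ.suc q) ≤∞ a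
≰fin⇒suc≤ -∞ a≰q = ⊥-elim (a≰q -∞≤)
≰fin⇒suc≤ (fin m) {q} a≰q with m ℤ.≤? q
... | yes m≤q = ⊥-elim (a≰q (fin≤ m≤q))
... | no m≰q = fin≤ (ℤP.i<j⇒suc[i]≤j (ℤP.≰⇒> m≰q))
≰fin⇒suc≤ +∞ a≰q = ≤+∞

≱fin⇒≤pred : ∀ a {p} → ¬ (fin p ≤∞ a) → a ≤∞ fin (ℤ.pred p)
≱fin⇒≤pred -∞ a≱p = -∞≤
≱fin⇒≤pred (fin m) {p} a≱p with p ℤ.≤? m
... | yes p≤m = ⊥-elim (a≱p (fin≤ p≤m))
... | no p≰m = fin≤ (ℤP.i<j⇒i≤pred[j] (ℤP.≰⇒> p≰m))
≱fin⇒≤pred +∞ a≱p = ⊥-elim (a≱p ≤+∞)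

module _ (lem : ExcludedMiddle 0ℓ) where

  IsInf-witness : ∀ {I : Set} {r f} q → IsInf {I} r f → r ≤∞ fin q → ∃[ i ] (f i ≤∞ fin q)
  IsInf-witness {f = f} q (_ , greatest) r≤q with lem {∃[ i ] (f i ≤∞ fin q)}
  ... | yes witness = witness
  ... | no none with ≤∞-trans (greatest _ (λ i → ≰fin⇒suc≤ (f i) (λ fi≤q → none (i , fi≤q)))) r≤q
  ... | fin≤ suc[q]≤q = ⊥-elim (ℤP.<-irrefl refl (ℤP.suc[i]≤j⇒i<j suc[q]≤q))

  IsSup-witness : ∀ {I : Set} {r f} p → IsSup {I} r f → fin p ≤∞ r → ∃[ i ] (fin p ≤∞ f i)
  IsSup-witness {f = f} p (_ , least) p≤r with lem {∃[ i ] (fin p ≤∞ f i)}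
  ... | yes witness = witness
  ... | no none with ≤∞-trans p≤r (least _ (λ i → ≱fin⇒≤pred (f i) (λ p≤fi → none (i , p≤fi))))
  ... | fin≤ p≤pred[p] = ⊥-elim (ℤP.<-irrefl refl (ℤP.i≤pred[j]⇒i<j p≤pred[p]))

⇓-subst : ∀ {C C′ σ σ′ p p′ τ τ′ q q′} → C ≡ C′ → σ ≡ σ′ → p ≡ p′ → τ ≡ τ′ → q ≡ q′ →
  C , σ , p ⇓ τ , q → C′ , σ′ , p′ ⇓ τ′ , q′
⇓-subst refl refl refl refl refl run = run

Run-shift : ∀ {C σ p l τ q} → Run C σ p l τ q → ∀ d → C , σ , (p ℤ.+ d) ⇓ τ , (q ℤ.+ d)
Run-shift r-skip d = _ , r-skip
Run-shift r-assign d = _ , r-assign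
Run-shift (r-assume b) d = _ , r-assume b
Run-shift (r-tick {e} {σ} {p}) d =
  ⇓-subst refl refl refl refl ([i+k]-j≡[i-j]+k p d (⟦ e ⟧ σ)) (_ , r-tick)
Run-shift (r-seq run₁ run₂) d = _ , r-seq (proj₂ (Run-shift run₁ d)) (proj₂ (Run-shift run₂ d))
Run-shift (r-choiceˡ run) d = _ , r-choiceˡ (proj₂ (Run-shift run d))
Run-shift (r-choiceʳ run) d = _ , r-choiceʳ (proj₂ (Run-shift run d))
Run-shift r-loop0 d = _ , r-loop0
Run-shift (r-loopS run) d = _ , r-loopS (proj₂ (Run-shift run d))
Run-shift (r-local run) d = _ , r-local (proj₂ (Run-shift run d))

⋆-snoc : ∀ {C σ p l ρ r τ q} → Run (C ⋆) σ p l ρ r → C , ρ , r ⇓ τ , q → (C ⋆) , σ , p ⇓ τ , q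
⋆-snoc r-loop0 (_ , run) = _ , r-loopS (r-seq run r-loop0)
⋆-snoc (r-loopS (r-seq run₁ runs)) run = _ , r-loopS (r-seq run₁ (proj₂ (⋆-snoc runs run)))

module _ (ext : Extensionality 0ℓ 0ℓ) where

  update-shadow : ∀ (σ : State) x u v → (σ [ x ↦ u ]) [ x ↦ v ] ≡ σ [ x ↦ v ]
  update-shadow σ x u v = ext pointwise
    where
    pointwise : ∀ w → ((σ [ x ↦ u ]) [ x ↦ v ]) w ≡ (σ [ x ↦ v ]) w
    pointwise w with w ≟ℕ x
    ... | yes refl = trans (update-same (σ [ w ↦ u ]) w v) (sym (update-same σ w v))
    ... | no w≢x = trans (update-other (σ [ x ↦ u ]) x v w≢x)
                         (trans (update-other σ x u w≢x) (sym (update-other σ x v w≢x)))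

  update-comm : ∀ (σ : State) x y u v → x ≢ y → (σ [ x ↦ u ]) [ y ↦ v ] ≡ (σ [ y ↦ v ]) [ x ↦ u ]
  update-comm σ x y u v x≢y = ext pointwise
    where
    open ≡-Reasoning
    pointwise : ∀ w → ((σ [ x ↦ u ]) [ y ↦ v ]) w ≡ ((σ [ y ↦ v ]) [ x ↦ u ]) w
    pointwise w with w ≟ℕ x | w ≟ℕ y
    ... | yes refl | yes refl = ⊥-elim (x≢y refl)
    ... | yes refl | no w≢y = begin
      ((σ [ w ↦ u ]) [ y ↦ v ]) w ≡⟨ update-other (σ [ w ↦ u ]) y v w≢y ⟩
      (σ [ w ↦ u ]) w             ≡⟨ update-same σ w u ⟩
      u                           ≡⟨ update-same (σ [ y ↦ v ]) w u ⟨
      ((σ [ y ↦ v ]) [ w ↦ u ]) w ∎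
    ... | no w≢x | yes refl = begin
      ((σ [ x ↦ u ]) [ w ↦ v ]) w ≡⟨ update-same (σ [ x ↦ u ]) w v ⟩
      v                           ≡⟨ update-same σ w v ⟨
      (σ [ w ↦ v ]) w             ≡⟨ update-other (σ [ w ↦ v ]) x u w≢x ⟨
      ((σ [ w ↦ v ]) [ x ↦ u ]) w ∎
    ... | no w≢x | no w≢y = begin
      ((σ [ x ↦ u ]) [ y ↦ v ]) w ≡⟨ update-other (σ [ x ↦ u ]) y v w≢y ⟩
      (σ [ x ↦ u ]) w             ≡⟨ update-other σ x u w≢x ⟩
      σ w                         ≡⟨ update-other σ y v w≢y ⟨
      (σ [ y ↦ v ]) w             ≡⟨ update-other (σ [ y ↦ v ]) x u w≢x ⟨
      ((σ [ y ↦ v ]) [ x ↦ u ]) w ∎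

  update-self : ∀ (σ : State) x → σ [ x ↦ σ x ] ≡ σ
  update-self σ x = ext pointwise
    where
    pointwise : ∀ w → (σ [ x ↦ σ x ]) w ≡ σ w
    pointwise w with w ≟ℕ x
    ... | yes refl = update-same σ w (σ w)
    ... | no w≢x = update-other σ x (σ x) w≢x

  update-revert : ∀ (σ : State) x v → (σ [ x ↦ v ]) [ x ↦ σ x ] ≡ σ
  update-revert σ x v = trans (update-shadow σ x v (σ x)) (update-self σ x)

  Run-preserves : ∀ {A : Set} (G : State → A) {C σ p l τ q} →
    (∀ x → Mod x C → ∀ ρ u → G (ρ [ x ↦ u ]) ≡ G ρ) → Run C σ p l τ q → G σ ≡ G τ
  Run-preserves G inv r-skip = refl
  Run-preserves G inv (r-assign {x} {e} {σ}) = sym (inv x refl σ (⟦ e ⟧ σ))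
  Run-preserves G inv (r-assume _) = refl
  Run-preserves G inv r-tick = refl
  Run-preserves G inv (r-seq run₁ run₂) =
    trans (Run-preserves G (λ x → inv x ∘ inj₁) run₁) (Run-preserves G (λ x → inv x ∘ inj₂) run₂)
  Run-preserves G inv (r-choiceˡ run) = Run-preserves G (λ x → inv x ∘ inj₁) run
  Run-preserves G inv (r-choiceʳ run) = Run-preserves G (λ x → inv x ∘ inj₂) run
  Run-preserves G inv r-loop0 = refl
  Run-preserves G inv (r-loopS run) =
    Run-preserves G (λ { x (inj₁ m) → inv x m ; x (inj₂ m) → inv x m }) run
  Run-preserves G inv (r-local {y} {C} {v = v} run) = Run-preserves (λ ρ → G (ρ [ y ↦ v ])) inv′ run
    where
    inv′ : ∀ x → Mod x C → ∀ ρ u → G ((ρ [ x ↦ u ]) [ y ↦ v ]) ≡ G (ρ [ y ↦ v ])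
    inv′ x m ρ u with x ≟ℕ y
    ... | yes refl = cong G (update-shadow ρ x u v)
    ... | no x≢y = trans (cong G (update-comm ρ x y u v x≢y)) (inv x (x≢y , m) (ρ [ y ↦ v ]) u)

  module Relocation (x y : Var) (w : ℤ) where

    -- The state in which renC y x C simulates C at σ: y takes over the value of x, while x, which
    -- no longer occurs in the renamed command, holds an arbitrary w.
    relocate : State → State
    relocate σ = (σ [ x ↦ w ]) [ y ↦ σ x ]

    relocate-restore : ∀ σ → relocate σ [ x ↦ relocate σ y ] ≡ σ [ y ↦ σ x ]
    relocate-restore σ rewrite update-same (σ [ x ↦ w ]) y (σ x) with x ≟ℕ y
    ... | yes refl = begin
      ((σ [ x ↦ w ]) [ x ↦ σ x ]) [ x ↦ σ x ] ≡⟨ update-shadow (σ [ x ↦ w ]) x (σ x) (σ x) ⟩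
      (σ [ x ↦ w ]) [ x ↦ σ x ]               ≡⟨ update-revert σ x w ⟩
      σ                                       ≡⟨ update-self σ x ⟨
      σ [ x ↦ σ x ]                           ∎
      where open ≡-Reasoning
    ... | no x≢y = begin
      ((σ [ x ↦ w ]) [ y ↦ σ x ]) [ x ↦ σ x ] ≡⟨ update-comm (σ [ x ↦ w ]) y x (σ x) (σ x) (x≢y ∘ sym) ⟩
      ((σ [ x ↦ w ]) [ x ↦ σ x ]) [ y ↦ σ x ] ≡⟨ cong (_[ y ↦ σ x ]) (update-revert σ x w) ⟩
      σ [ y ↦ σ x ]                           ∎
      where open ≡-Reasoning

    ⟦renA⟧-relocate : ∀ e σ → ¬ FvA y e → ⟦ renA y x e ⟧ (relocate σ) ≡ ⟦ e ⟧ σ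
    ⟦renA⟧-relocate e σ y∉e = begin
      ⟦ renA y x e ⟧ (relocate σ)                 ≡⟨ ⟦renA⟧ y x e (relocate σ) ⟩
      ⟦ e ⟧ (relocate σ [ x ↦ relocate σ y ])     ≡⟨ cong ⟦ e ⟧ (relocate-restore σ) ⟩
      ⟦ e ⟧ (σ [ y ↦ σ x ])                       ≡⟨ ⟦⟧-update-fresh e y∉e σ (σ x) ⟩
      ⟦ e ⟧ σ                                     ∎
      where open ≡-Reasoning

    ⟦renB⟧-relocate : ∀ B σ → ¬ FvB y B → ⟦ renB y x B ⟧B (relocate σ) ≡ ⟦ B ⟧B σ
    ⟦renB⟧-relocate B σ y∉B = begin
      ⟦ renB y x B ⟧B (relocate σ)                ≡⟨ ⟦renB⟧ y x B (relocate σ) ⟩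
      ⟦ B ⟧B (relocate σ [ x ↦ relocate σ y ])    ≡⟨ cong ⟦ B ⟧B (relocate-restore σ) ⟩
      ⟦ B ⟧B (σ [ y ↦ σ x ])                      ≡⟨ ⟦⟧B-update-fresh B y∉B σ (σ x) ⟩
      ⟦ B ⟧B σ                                    ∎
      where open ≡-Reasoning

    relocate-update-source : ∀ σ v → relocate σ [ y ↦ v ] ≡ relocate (σ [ x ↦ v ])
    relocate-update-source σ v = begin
      ((σ [ x ↦ w ]) [ y ↦ σ x ]) [ y ↦ v ]
        ≡⟨ update-shadow (σ [ x ↦ w ]) y (σ x) v ⟩
      (σ [ x ↦ w ]) [ y ↦ v ]
        ≡⟨ cong₂ (λ ρ u → ρ [ y ↦ u ]) (sym (update-shadow σ x v w)) (sym (update-same σ x v)) ⟩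
      ((σ [ x ↦ v ]) [ x ↦ w ]) [ y ↦ (σ [ x ↦ v ]) x ]
        ∎
      where open ≡-Reasoning

    relocate-update-other : ∀ σ z v → z ≢ x → z ≢ y → relocate σ [ z ↦ v ] ≡ relocate (σ [ z ↦ v ])
    relocate-update-other σ z v z≢x z≢y = begin
      ((σ [ x ↦ w ]) [ y ↦ σ x ]) [ z ↦ v ]
        ≡⟨ update-comm (σ [ x ↦ w ]) z y v (σ x) z≢y ⟨
      ((σ [ x ↦ w ]) [ z ↦ v ]) [ y ↦ σ x ]
        ≡⟨ cong₂ (λ ρ u → ρ [ y ↦ u ]) (sym (update-comm σ z x v w z≢x))
                                        (sym (update-other σ z v (z≢x ∘ sym))) ⟩
      ((σ [ z ↦ v ]) [ x ↦ w ]) [ y ↦ (σ [ z ↦ v ]) x ]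
        ∎
      where open ≡-Reasoning

    relocate-run : ∀ {C σ p l τ q} → ¬ OccC y C → Run C σ p l τ q →
      renC y x C , relocate σ , p ⇓ relocate τ , q
    relocate-run y∉C r-skip = _ , r-skip
    relocate-run y∉C (r-assign {z} {e} {σ}) with z ≟ℕ x
    ... | yes refl =
      ⇓-subst (cong (_≔ renA y x e) (sym (renV-same y x))) refl refl
        (trans (cong (relocate σ [ y ↦_]) (⟦renA⟧-relocate e σ (y∉C ∘ inj₂)))
               (relocate-update-source σ _)) refl
        (_ , r-assign)
    ... | no z≢x =
      ⇓-subst (cong (_≔ renA y x e) (sym (renV-other y x z≢x))) refl refl
        (trans (cong (relocate σ [ z ↦_]) (⟦renA⟧-relocate e σ (y∉C ∘ inj₂)))
               (relocate-update-other σ z _ z≢x (y∉C ∘ inj₁ ∘ sym))) refl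
        (_ , r-assign)
    relocate-run y∉C (r-assume {B} {σ} B-true) = _ , r-assume (trans (⟦renB⟧-relocate B σ y∉C) B-true)
    relocate-run y∉C (r-tick {e} {σ} {p}) =
      ⇓-subst refl refl refl refl (cong (λ k → p ℤ.- k) (⟦renA⟧-relocate e σ y∉C)) (_ , r-tick)
    relocate-run y∉C (r-seq run₁ run₂) =
      _ , r-seq (proj₂ (relocate-run (y∉C ∘ inj₁) run₁)) (proj₂ (relocate-run (y∉C ∘ inj₂) run₂))
    relocate-run y∉C (r-choiceˡ run) = _ , r-choiceˡ (proj₂ (relocate-run (y∉C ∘ inj₁) run))
    relocate-run y∉C (r-choiceʳ run) = _ , r-choiceʳ (proj₂ (relocate-run (y∉C ∘ inj₂) run))
    relocate-run y∉C r-loop0 = _ , r-loop0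
    relocate-run y∉C (r-loopS run) =
      _ , r-loopS (proj₂ (relocate-run (λ { (inj₁ o) → y∉C o ; (inj₂ o) → y∉C o }) run))
    relocate-run y∉C (r-local {z} {C} {σ} {τ = τ} {v = v} run)
      with relocate-run (y∉C ∘ inj₂) run | z ≟ℕ x
    ... | _ , run′ | yes refl =
      ⇓-subst (cong (λ t → local t ∙ renC y x C) (sym (renV-same y x)))
        (relocate-update-source σ v) refl (relocate-update-source τ v) refl (_ , r-local run′)
    ... | _ , run′ | no z≢x =
      ⇓-subst (cong (λ t → local t ∙ renC y x C) (sym (renV-other y x z≢x)))
        (relocate-update-other σ z v z≢x (y∉C ∘ inj₁ ∘ sym)) refl
        (relocate-update-other τ z v z≢x (y∉C ∘ inj₁ ∘ sym)) refl (_ , r-local run′)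

  open Relocation using (relocate; relocate-restore; relocate-run)

  relocate-update : ∀ x y (τ : State) → relocate x y (τ x) (τ [ x ↦ τ y ]) ≡ τ
  relocate-update x y τ = begin
    ((τ [ x ↦ τ y ]) [ x ↦ τ x ]) [ y ↦ (τ [ x ↦ τ y ]) x ]
      ≡⟨ cong₂ (λ ρ u → ρ [ y ↦ u ]) (update-revert τ x (τ y)) (update-same τ x (τ y)) ⟩
    τ [ y ↦ τ y ]
      ≡⟨ update-self τ y ⟩
    τ
      ∎
    where open ≡-Reasoning

  ⟦⟧B-unmodified : ∀ B C → (∀ x → FvB x B → ¬ Mod x C) → ∀ x → Mod x C → ∀ ρ u →
    ⟦ B ⟧B (ρ [ x ↦ u ]) ≡ ⟦ B ⟧B ρ
  ⟦⟧B-unmodified B C B#C x x∈C = ⟦⟧B-update-fresh B (λ x∈B → B#C x x∈B x∈C)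

  ⊨F-skip : ∀ {P} → ⊨F[ P ] skip [ P ]
  ⊨F-skip τ q h = τ , q , h , (_ , r-skip)

  ⊨F-assume : ∀ {P B} → ⊨F[ maxR P ⟪ bnot B ⟫ ] assume B [ maxR P ⟪ bnot B ⟫ ]
  ⊨F-assume {P} {B} τ q h =
    τ , q , h , (_ , r-assume (not-injective (⟪⟫≤fin⇒false (bnot B) τ (proj₂ (max∞-≤-inv (P τ) _ h)))))

  ⊨F-tick : ∀ {P e} → ⊨F[ P ] tick e [ P -R e ]
  ⊨F-tick {P} {e} τ q h =
    τ , q ℤ.+ ⟦ e ⟧ τ , -∞ℤ≤fin⇒≤fin (P τ) _ q h ,
    ⇓-subst refl refl refl refl ([i+j]-j≡i q (⟦ e ⟧ τ)) (_ , r-tick)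

  ⊨F-seq : ∀ {P R Q C₁ C₂} → ⊨F[ P ] C₁ [ R ] → ⊨F[ R ] C₂ [ Q ] → ⊨F[ P ] C₁ ⨾ C₂ [ Q ]
  ⊨F-seq ⊨C₁ ⊨C₂ τ q h with ⊨C₂ τ q h
  ... | ρ , r , hρ , (_ , run₂) with ⊨C₁ ρ r hρ
  ... | σ , p , hσ , (_ , run₁) = σ , p , hσ , (_ , r-seq run₁ run₂)

  ⊨F-choiceˡ : ∀ {P Q C₁ C₂} → ⊨F[ P ] C₁ [ Q ] → ⊨F[ P ] C₁ ⊹ C₂ [ Q ]
  ⊨F-choiceˡ ⊨C τ q h with ⊨C τ q h
  ... | σ , p , hσ , (_ , run) = σ , p , hσ , (_ , r-choiceˡ run)

  ⊨F-choiceʳ : ∀ {P Q C₁ C₂} → ⊨F[ P ] C₂ [ Q ] → ⊨F[ P ] C₁ ⊹ C₂ [ Q ]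
  ⊨F-choiceʳ ⊨C τ q h with ⊨C τ q h
  ... | σ , p , hσ , (_ , run) = σ , p , hσ , (_ , r-choiceʳ run)

  ⊨F-loop : ∀ {C} (P : ℕ → ResFn) k → (∀ n → n <ℕ k → ⊨F[ P n ] C [ P (suc n) ]) → ⊨F[ P 0 ] C ⋆ [ P k ]
  ⊨F-loop P zero ⊨C τ q h = τ , q , h , (_ , r-loop0)
  ⊨F-loop P (suc k) ⊨C τ q h with ⊨C k (ℕP.n<1+n k) τ q h
  ... | ρ , r , hρ , run with ⊨F-loop P k (λ n n<k → ⊨C n (ℕP.m<n⇒m<1+n n<k)) ρ r hρ
  ... | σ , p , hσ , (_ , runs) = σ , p , hσ , ⋆-snoc runs run

  ⊨F-constancy : ∀ {P Q C B} → ⊨F[ P ] C [ Q ] → (∀ x → FvB x B → ¬ Mod x C) →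
    ⊨F[ maxR P ⟪ B ⟫ ] C [ maxR Q ⟪ B ⟫ ]
  ⊨F-constancy {P} {Q} {C} {B} ⊨C B#C τ q h with max∞-≤-inv (Q τ) _ h
  ... | hQ , hB with ⊨C τ q hQ
  ... | σ , p , hσ , (_ , run) =
    σ , p , subst (_≤∞ fin p) (sym (max∞-⟪false⟫ (P σ) B σ B-false)) hσ , (_ , run)
    where
    B-false : ⟦ B ⟧B σ ≡ false
    B-false = trans (Run-preserves ⟦ B ⟧B (⟦⟧B-unmodified B C B#C) run) (⟪⟫≤fin⇒false B τ hB)

  ⊨F-relax : ∀ {P Q C F} → ⊨F[ P ] C [ Q ] → (∀ x → Mod x C → NotFreeR x F) →
    ⊨F[ P +⊤R F ] C [ Q +⊤R F ]
  ⊨F-relax {P} {Q} {C} {F} ⊨C F#C τ q h with +⊤-≤fin-split (Q τ) (F τ) q h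
  ... | d , hQ , shift-bound with ⊨C τ (q ℤ.- d) hQ
  ... | σ , p , hσ , (_ , run) =
    σ , p ℤ.+ d ,
    subst (λ f → P σ +⊤ f ≤∞ fin (p ℤ.+ d)) (sym (Run-preserves F F#C run)) (shift-bound (P σ) p hσ) ,
    ⇓-subst refl refl refl refl ([i-j]+j≡i q d) (Run-shift run d)

  ⊨F-conseq : ∀ {P P′ Q Q′ C} → P ⪯ P′ → ⊨F[ P′ ] C [ Q′ ] → Q′ ⪯ Q → ⊨F[ P ] C [ Q ]
  ⊨F-conseq P⪯P′ ⊨C Q′⪯Q τ q h with ⊨C τ q (≤∞-trans (Q′⪯Q τ) h)
  ... | σ , p , hσ , run = σ , p , ≤∞-trans (P⪯P′ σ) hσ , run

  ⊨F-subst : ∀ {P Q C x y} → ⊨F[ P ] C [ Q ] → NotFreeR y P → ¬ OccC y C →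
    ⊨F[ P [ y / x ]R ] renC y x C [ Q [ y / x ]R ]
  ⊨F-subst {P} {x = x} {y} ⊨C y∉P y∉C τ q h with ⊨C (τ [ x ↦ τ y ]) q h
  ... | σ , p , hσ , (_ , run) =
    relocate x y (τ x) σ , p , subst (_≤∞ fin p) (sym P-relocated) hσ ,
    ⇓-subst refl refl refl (relocate-update x y τ) refl (relocate-run x y (τ x) y∉C run)
    where
    P-relocated : (P [ y / x ]R) (relocate x y (τ x) σ) ≡ P σ
    P-relocated = trans (cong P (relocate-restore x y (τ x) σ)) (y∉P σ (σ x))

  ⊨B-skip : ∀ {P} → ⊨B[ P ] skip [ P ]
  ⊨B-skip σ p h = σ , p , h , (_ , r-skip)

  ⊨B-assume : ∀ {P B} → ⊨B[ minR P ⟪ B ⟫ ] assume B [ minR P ⟪ B ⟫ ]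
  ⊨B-assume {P} {B} σ p h = σ , p , h , (_ , r-assume (fin≤⟪⟫⇒true B σ (proj₂ (min∞-≥-inv (P σ) _ h))))

  ⊨B-tick : ∀ {P e} → ⊨B[ P ] tick e [ P -R e ]
  ⊨B-tick {P} {e} σ p h = σ , p ℤ.- ⟦ e ⟧ σ , fin≤⇒fin≤-∞ℤ (P σ) (⟦ e ⟧ σ) h , (_ , r-tick)

  ⊨B-seq : ∀ {P R Q C₁ C₂} → ⊨B[ P ] C₁ [ R ] → ⊨B[ R ] C₂ [ Q ] → ⊨B[ P ] C₁ ⨾ C₂ [ Q ]
  ⊨B-seq ⊨C₁ ⊨C₂ σ p h with ⊨C₁ σ p h
  ... | ρ , r , hρ , (_ , run₁) with ⊨C₂ ρ r hρ
  ... | τ , q , hτ , (_ , run₂) = τ , q , hτ , (_ , r-seq run₁ run₂)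

  ⊨B-choiceˡ : ∀ {P Q C₁ C₂} → ⊨B[ P ] C₁ [ Q ] → ⊨B[ P ] C₁ ⊹ C₂ [ Q ]
  ⊨B-choiceˡ ⊨C σ p h with ⊨C σ p h
  ... | τ , q , hτ , (_ , run) = τ , q , hτ , (_ , r-choiceˡ run)

  ⊨B-choiceʳ : ∀ {P Q C₁ C₂} → ⊨B[ P ] C₂ [ Q ] → ⊨B[ P ] C₁ ⊹ C₂ [ Q ]
  ⊨B-choiceʳ ⊨C σ p h with ⊨C σ p h
  ... | τ , q , hτ , (_ , run) = τ , q , hτ , (_ , r-choiceʳ run)

  ⊨B-loop : ∀ {C} (P : ℕ → ResFn) k → (∀ n → n <ℕ k → ⊨B[ P n ] C [ P (suc n) ]) → ⊨B[ P 0 ] C ⋆ [ P k ]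
  ⊨B-loop P zero ⊨C σ p h = σ , p , h , (_ , r-loop0)
  ⊨B-loop P (suc k) ⊨C σ p h with ⊨B-loop P k (λ n n<k → ⊨C n (ℕP.m<n⇒m<1+n n<k)) σ p h
  ... | ρ , r , hρ , (_ , runs) with ⊨C k (ℕP.n<1+n k) ρ r hρ
  ... | τ , q , hτ , run = τ , q , hτ , ⋆-snoc runs run

  ⊨B-constancy : ∀ {P Q C B} → ⊨B[ P ] C [ Q ] → (∀ x → FvB x B → ¬ Mod x C) →
    ⊨B[ minR P ⟪ B ⟫ ] C [ minR Q ⟪ B ⟫ ]
  ⊨B-constancy {P} {Q} {C} {B} ⊨C B#C σ p h with min∞-≥-inv (P σ) _ h
  ... | hP , hB with ⊨C σ p hP
  ... | τ , q , hτ , (_ , run) =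
    τ , q , subst (fin q ≤∞_) (sym (min∞-⟪true⟫ (Q τ) B τ B-true)) hτ , (_ , run)
    where
    B-true : ⟦ B ⟧B τ ≡ true
    B-true = trans (sym (Run-preserves ⟦ B ⟧B (⟦⟧B-unmodified B C B#C) run)) (fin≤⟪⟫⇒true B σ hB)

  ⊨B-relax : ∀ {P Q C F} → ⊨B[ P ] C [ Q ] → (∀ x → Mod x C → NotFreeR x F) →
    ⊨B[ P +⊥R F ] C [ Q +⊥R F ]
  ⊨B-relax {P} {Q} {C} {F} ⊨C F#C σ p h with +⊥-fin≤-split (P σ) (F σ) p h
  ... | d , hP , shift-bound with ⊨C σ (p ℤ.- d) hP
  ... | τ , q , hτ , (_ , run) =
    τ , q ℤ.+ d ,
    subst (λ f → fin (q ℤ.+ d) ≤∞ Q τ +⊥ f) (Run-preserves F F#C run) (shift-bound (Q τ) q hτ) ,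
    ⇓-subst refl refl ([i-j]+j≡i p d) refl refl (Run-shift run d)

  ⊨B-conseq : ∀ {P P′ Q Q′ C} → P ⪯ P′ → ⊨B[ P′ ] C [ Q′ ] → Q′ ⪯ Q → ⊨B[ P ] C [ Q ]
  ⊨B-conseq P⪯P′ ⊨C Q′⪯Q σ p h with ⊨C σ p (≤∞-trans h (P⪯P′ σ))
  ... | τ , q , hτ , run = τ , q , ≤∞-trans hτ (Q′⪯Q τ) , run

  ⊨B-subst : ∀ {P Q C x y} → ⊨B[ P ] C [ Q ] → NotFreeR y Q → ¬ OccC y C →
    ⊨B[ P [ y / x ]R ] renC y x C [ Q [ y / x ]R ]
  ⊨B-subst {Q = Q} {x = x} {y} ⊨C y∉Q y∉C σ p h with ⊨C (σ [ x ↦ σ y ]) p h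
  ... | τ , q , hτ , (_ , run) =
    relocate x y (σ x) τ , q , subst (fin q ≤∞_) (sym Q-relocated) hτ ,
    ⇓-subst refl (relocate-update x y σ) refl refl refl (relocate-run x y (σ x) y∉C run)
    where
    Q-relocated : (Q [ y / x ]R) (relocate x y (σ x) τ) ≡ Q τ
    Q-relocated = trans (cong Q (relocate-restore x y (σ x) τ)) (y∉Q τ (τ x))

  module _ {x x′ : Var} (x′≢x : x′ ≢ x) where

    update-rename-fresh : ∀ (σ : State) v →
      (σ [ x′ ↦ v ]) [ x ↦ (σ [ x′ ↦ v ]) x′ ] ≡ (σ [ x ↦ v ]) [ x′ ↦ v ]
    update-rename-fresh σ v =
      trans (cong ((σ [ x′ ↦ v ]) [ x ↦_]) (update-same σ x′ v)) (update-comm σ x′ x v v x′≢x)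

    ⟦renA⟧-fresh : ∀ e → ¬ FvA x′ e → ∀ σ v → ⟦ renA x′ x e ⟧ (σ [ x′ ↦ v ]) ≡ ⟦ e ⟧ (σ [ x ↦ v ])
    ⟦renA⟧-fresh e x′∉e σ v = begin
      ⟦ renA x′ x e ⟧ (σ [ x′ ↦ v ])                       ≡⟨ ⟦renA⟧ x′ x e (σ [ x′ ↦ v ]) ⟩
      ⟦ e ⟧ ((σ [ x′ ↦ v ]) [ x ↦ (σ [ x′ ↦ v ]) x′ ])     ≡⟨ cong ⟦ e ⟧ (update-rename-fresh σ v) ⟩
      ⟦ e ⟧ ((σ [ x ↦ v ]) [ x′ ↦ v ])                     ≡⟨ ⟦⟧-update-fresh e x′∉e (σ [ x ↦ v ]) v ⟩
      ⟦ e ⟧ (σ [ x ↦ v ])                                  ∎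
      where open ≡-Reasoning

    [/]R-fresh : ∀ P → NotFreeR x′ P → ∀ σ v → (P [ x′ / x ]R) (σ [ x′ ↦ v ]) ≡ P (σ [ x ↦ v ])
    [/]R-fresh P x′∉P σ v = trans (cong P (update-rename-fresh σ v)) (x′∉P (σ [ x ↦ v ]) v)

  module _ (lem : ExcludedMiddle 0ℓ) where

    ⊨F-assign : ∀ {P Q x x′ e} → x′ ≢ x → NotFreeR x′ P → ¬ FvA x′ e →
      IsInfX x′ (λ σ → max∞ ((P [ x′ / x ]R) σ) (⟪ bnot (var x =ₑ renA x′ x e) ⟫ σ)) Q →
      ⊨F[ P ] x ≔ e [ Q ]
    ⊨F-assign {P} {x = x} {x′} {e} x′≢x x′∉P x′∉e Q-inf τ q h with IsInf-witness lem q (Q-inf τ) h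
    ... | v , hv with max∞-≤-inv _ _ hv
    ... | hP , hx≡e =
      τ [ x ↦ v ] , q , subst (_≤∞ fin q) ([/]R-fresh x′≢x P x′∉P τ v) hP ,
      ⇓-subst refl refl refl (trans (cong ((τ [ x ↦ v ]) [ x ↦_]) (sym τx≡e)) (update-revert τ x v)) refl
        (_ , r-assign)
      where
      τx≡e : τ x ≡ ⟦ e ⟧ (τ [ x ↦ v ])
      τx≡e = begin
        τ x                                ≡⟨ update-other τ x′ v (x′≢x ∘ sym) ⟨
        (τ [ x′ ↦ v ]) x                   ≡⟨ ⟪≢⟫≤fin⇒≡ (var x) (renA x′ x e) (τ [ x′ ↦ v ]) hx≡e ⟩
        ⟦ renA x′ x e ⟧ (τ [ x′ ↦ v ])     ≡⟨ ⟦renA⟧-fresh x′≢x e x′∉e τ v ⟩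
        ⟦ e ⟧ (τ [ x ↦ v ])                ∎
        where open ≡-Reasoning

    ⊨B-assign : ∀ {P Q x x′ e} → x′ ≢ x → NotFreeR x′ P → ¬ FvA x′ e →
      IsSupX x′ (λ σ → min∞ ((P [ x′ / x ]R) σ) (⟪ var x =ₑ renA x′ x e ⟫ σ)) Q →
      ⊨B[ P ] x ≔ e [ Q ]
    ⊨B-assign {P} {x = x} {x′} {e} x′≢x x′∉P x′∉e Q-sup σ p h =
      τ , p , ≤∞-trans (min∞-glb hP hx≡e) (proj₁ (Q-sup τ) (σ x)) , (_ , r-assign)
      where
      τ = σ [ x ↦ ⟦ e ⟧ σ ]
      hP : fin p ≤∞ (P [ x′ / x ]R) (τ [ x′ ↦ σ x ])
      hP = subst (fin p ≤∞_)
             (sym (trans ([/]R-fresh x′≢x P x′∉P τ (σ x)) (cong P (update-revert σ x (⟦ e ⟧ σ))))) h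
      hx≡e : fin p ≤∞ ⟪ var x =ₑ renA x′ x e ⟫ (τ [ x′ ↦ σ x ])
      hx≡e = ≡⇒fin≤⟪≡⟫ (var x) (renA x′ x e) (τ [ x′ ↦ σ x ]) (begin
        (τ [ x′ ↦ σ x ]) x                 ≡⟨ update-other τ x′ (σ x) (x′≢x ∘ sym) ⟩
        τ x                                ≡⟨ update-same σ x (⟦ e ⟧ σ) ⟩
        ⟦ e ⟧ σ                            ≡⟨ cong ⟦ e ⟧ (update-revert σ x (⟦ e ⟧ σ)) ⟨
        ⟦ e ⟧ (τ [ x ↦ σ x ])              ≡⟨ ⟦renA⟧-fresh x′≢x e x′∉e τ (σ x) ⟨
        ⟦ renA x′ x e ⟧ (τ [ x′ ↦ σ x ])   ∎)
        where open ≡-Reasoning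

    ⊨F-local : ∀ {P Q P′ Q′ x C} → ⊨F[ P ] C [ Q ] → IsInfX x P P′ → IsInfX x Q Q′ →
      ⊨F[ P′ ] local x ∙ C [ Q′ ]
    ⊨F-local {P} {P′ = P′} {x = x} ⊨C P-inf Q-inf τ q h with IsInf-witness lem q (Q-inf τ) h
    ... | v , hv with ⊨C (τ [ x ↦ v ]) q hv
    ... | σ , p , hσ , (_ , run) =
      σ [ x ↦ τ x ] , p , ≤∞-trans P′≤P hσ ,
      ⇓-subst refl refl refl (update-revert τ x v) refl (_ , r-local run)
      where
      P′≤P : P′ (σ [ x ↦ τ x ]) ≤∞ P σ
      P′≤P = subst (λ ρ → P′ (σ [ x ↦ τ x ]) ≤∞ P ρ) (update-revert σ x (τ x))
                   (proj₁ (P-inf (σ [ x ↦ τ x ])) (σ x))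

    ⊨B-local : ∀ {P Q P′ Q′ x C} → ⊨B[ P ] C [ Q ] → IsSupX x P P′ → IsSupX x Q Q′ →
      ⊨B[ P′ ] local x ∙ C [ Q′ ]
    ⊨B-local {Q = Q} {Q′ = Q′} {x = x} ⊨C P-sup Q-sup σ p h with IsSup-witness lem p (P-sup σ) h
    ... | v , hv with ⊨C (σ [ x ↦ v ]) p hv
    ... | τ , q , hτ , (_ , run) =
      τ [ x ↦ σ x ] , q , ≤∞-trans hτ Q≤Q′ ,
      ⇓-subst refl (update-revert σ x v) refl refl refl (_ , r-local run)
      where
      Q≤Q′ : Q τ ≤∞ Q′ (τ [ x ↦ σ x ])
      Q≤Q′ = subst (λ ρ → Q ρ ≤∞ Q′ (τ [ x ↦ σ x ])) (update-revert τ x (σ x))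
                   (proj₁ (Q-sup (τ [ x ↦ σ x ])) (τ x))

    ⊨F-conj : ∀ {C P Q} (I : Set) (Ps Qs : I → ResFn) → (∀ i → ⊨F[ Ps i ] C [ Qs i ]) →
      (∀ σ → IsInf (P σ) (λ i → Ps i σ)) → (∀ σ → IsInf (Q σ) (λ i → Qs i σ)) → ⊨F[ P ] C [ Q ]
    ⊨F-conj I Ps Qs ⊨C P-inf Q-inf τ q h with IsInf-witness lem q (Q-inf τ) h
    ... | i , hi with ⊨C i τ q hi
    ... | σ , p , hσ , run = σ , p , ≤∞-trans (proj₁ (P-inf σ) i) hσ , run

    ⊨B-disj : ∀ {C P Q} (I : Set) (Ps Qs : I → ResFn) → (∀ i → ⊨B[ Ps i ] C [ Qs i ]) →
      (∀ σ → IsSup (P σ) (λ i → Ps i σ)) → (∀ σ → IsSup (Q σ) (λ i → Qs i σ)) → ⊨B[ P ] C [ Q ]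
    ⊨B-disj I Ps Qs ⊨C P-sup Q-sup σ p h with IsSup-witness lem p (P-sup σ) h
    ... | i , hi with ⊨C i σ p hi
    ... | τ , q , hτ , run = τ , q , ≤∞-trans hτ (proj₁ (Q-sup τ) i) , run

    QFUA-sound : ∀ {P C Q} → ⊢F[ P ] C [ Q ] → ⊨F[ P ] C [ Q ]
    QFUA-sound F-skip = ⊨F-skip
    QFUA-sound (F-assign x′≢x x′∉P x′∉e Q-inf) = ⊨F-assign x′≢x x′∉P x′∉e Q-inf
    QFUA-sound F-assume = ⊨F-assume
    QFUA-sound F-tick = ⊨F-tick
    QFUA-sound (F-seq ⊢C₁ ⊢C₂) = ⊨F-seq (QFUA-sound ⊢C₁) (QFUA-sound ⊢C₂)
    QFUA-sound (F-choiceˡ ⊢C) = ⊨F-choiceˡ (QFUA-sound ⊢C)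
    QFUA-sound (F-choiceʳ ⊢C) = ⊨F-choiceʳ (QFUA-sound ⊢C)
    QFUA-sound (F-loop P k ⊢C) = ⊨F-loop P k (λ n n<k → QFUA-sound (⊢C n n<k))
    QFUA-sound (F-local ⊢C P-inf Q-inf) = ⊨F-local (QFUA-sound ⊢C) P-inf Q-inf
    QFUA-sound (F-conj I Ps Qs ⊢C P-inf Q-inf) = ⊨F-conj I Ps Qs (λ i → QFUA-sound (⊢C i)) P-inf Q-inf
    QFUA-sound (F-constancy {B = B} ⊢C B#C) = ⊨F-constancy {B = B} (QFUA-sound ⊢C) B#C
    QFUA-sound (F-relax ⊢C F#C) = ⊨F-relax (QFUA-sound ⊢C) F#C
    QFUA-sound (F-conseq P⪯P′ ⊢C Q′⪯Q) = ⊨F-conseq P⪯P′ (QFUA-sound ⊢C) Q′⪯Q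
    QFUA-sound (F-subst ⊢C y∉P _ y∉C) = ⊨F-subst (QFUA-sound ⊢C) y∉P y∉C

    QBUA-sound : ∀ {P C Q} → ⊢B[ P ] C [ Q ] → ⊨B[ P ] C [ Q ]
    QBUA-sound B-skip = ⊨B-skip
    QBUA-sound (B-assign x′≢x x′∉P x′∉e Q-sup) = ⊨B-assign x′≢x x′∉P x′∉e Q-sup
    QBUA-sound B-assume = ⊨B-assume
    QBUA-sound B-tick = ⊨B-tick
    QBUA-sound (B-seq ⊢C₁ ⊢C₂) = ⊨B-seq (QBUA-sound ⊢C₁) (QBUA-sound ⊢C₂)
    QBUA-sound (B-choiceˡ ⊢C) = ⊨B-choiceˡ (QBUA-sound ⊢C)
    QBUA-sound (B-choiceʳ ⊢C) = ⊨B-choiceʳ (QBUA-sound ⊢C)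
    QBUA-sound (B-loop P k ⊢C) = ⊨B-loop P k (λ n n<k → QBUA-sound (⊢C n n<k))
    QBUA-sound (B-local ⊢C P-sup Q-sup) = ⊨B-local (QBUA-sound ⊢C) P-sup Q-sup
    QBUA-sound (B-disj I Ps Qs ⊢C P-sup Q-sup) = ⊨B-disj I Ps Qs (λ i → QBUA-sound (⊢C i)) P-sup Q-sup
    QBUA-sound (B-constancy {B = B} ⊢C B#C) = ⊨B-constancy {B = B} (QBUA-sound ⊢C) B#C
    QBUA-sound (B-relax ⊢C F#C) = ⊨B-relax (QBUA-sound ⊢C) F#C
    QBUA-sound (B-conseq P⪯P′ ⊢C Q′⪯Q) = ⊨B-conseq P⪯P′ (QBUA-sound ⊢C) Q′⪯Q
    QBUA-sound (B-subst ⊢C _ y∉Q y∉C) = ⊨B-subst (QBUA-sound ⊢C) y∉Q y∉C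

theorem1 : Extensionality 0ℓ 0ℓ → ExcludedMiddle 0ℓ →
    (∀ P C Q → ⊢F[ P ] C [ Q ] → ⊨F[ P ] C [ Q ])
    × (∀ P C Q → ⊢B[ P ] C [ Q ] → ⊨B[ P ] C [ Q ])
theorem1 ext lem = (λ _ _ _ → QFUA-sound ext lem) , (λ _ _ _ → QBUA-sound ext lem)
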